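{- Let $\Sigma$, $\rho$, $E(x,y)$, $\mathbb Q$, $\mathbb{IQ}$ and $\mathcal I$ be as in the context. Then: (i) for each $J\in\mathbb{IQ}$ and each $f\in\Sigma$, the set $C(J)=\{x\in J\mid\nabla x=x=\Delta x\}$ is closed under $f^J$; (ii) the assignment $\mathcal C\colon\mathbb{IQ}\to\mathbb Q$ sending $J$ to the $\Sigma$-algebra $\mathcal C(J)$ with universe $C(J)$ and operations $f^J$ restricted to $C(J)$, and sending a homomorphism $g\colon J\to K$ to its restriction to $C(J)$, is a well-defined faithful functor (in particular $\mathcal C(J)\in\mathbb Q$); (iii) for each $A\in\mathbb Q$ the map $\iota_A\colon A\to\mathcal C(\mathcal I(A))$, $\iota_A(a)=[a,a]$, is an isomorphism, and $A\mapsto\iota_A$ is a natural isomorphism from the identity functor of $\mathbb Q$ to $\mathcal C\circ\mathcal I$; (iv) for each $J\in\mathbb{IQ}$ the map $\gamma_J\colon J\to\mathcal I(\mathcal C(J))$, $\gamma_J(a)=[\Delta a,\nabla a]$, is a one-to-one homomorphism, and $J\mapsto\gamma_J$ is a natural transformation from the identity functor of $\mathbb{IQ}$ to $\mathcal I\circ\mathcal C$.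
   Context: $\Sigma$ is a set of constant and function symbols containing constants $0,1$. A polarity $\rho$ assigns to each $n$-ary function symbol $f\in\Sigma$ a tuple $\rho(f)\in\{+,-\}^n$. A $\rho$-poalgebra is a pair $(A,\leq)$ with $A$ a $\Sigma$-algebra and $\leq$ a partial order on $A$ such that each $f^A$ is monotone in its $k$-th argument if $\rho(f)_k=+$ and antitone if $\rho(f)_k=-$; it is bounded if $0^A\leq a\leq 1^A$ for all $a$. For a bounded $\rho$-poalgebra $A$, $\mathcal I(A)$ is the $(\Sigma\cup\{\Delta,\nabla,\iota\})$-algebra on $I(A)=\{[a,b]\mid a\leq b\}$ with $f^{\mathcal I(A)}([a_1,b_1],\dots,[a_n,b_n])=[f^A(c_1,\dots,c_n),f^A(d_1,\dots,d_n)]$, where $c_k=a_k,d_k=b_k$ if $\rho(f)_k=+$ and $c_k=b_k,d_k=a_k$ if $\rho(f)_k=-$, $\Delta[a,b]=[a,a]$, $\nabla[a,b]=[b,b]$, $\iota=[0^A,1^A]$. A set $E(x,y)$ of $\Sigma$-equations determines the order of $A$ if $a\leq b$ iff $t^A(a,b)=s^A(a,b)$ for all $t=s$ in $E(x,y)$. Standing assumptions: $\mathbb Q$ is a $\Sigma$-quasivariety of bounded $\rho$-poalgebras whose order is determined by a fixed set $E(x,y)$ of $\Sigma$-equations; $\mathbb{IQ}$ is the quasivariety generated by $\{\mathcal I(A)\mid A\in\mathbb Q\}$; both are categories with homomorphisms. $\mathcal I\colon\mathbb Q\to\mathbb{IQ}$ is the functor $A\mapsto\mathcal I(A)$, $h\mapsto\mathcal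 I(h)$ with $\mathcal I(h)([a,b])=[h(a),h(b)]$. -}

module Defs where

open import Level using (Level; _⊔_) renaming (suc to lsuc; zero to lzero)
open import Data.Nat using (ℕ; zero; suc)
open import Data.Fin using (Fin; zero; suc)
open import Data.Fin.Properties using (_≟_; suc-injective)
open import Data.Product using (Σ; _×_; _,_; proj₁; proj₂)
open import Data.Empty using (⊥-elim)
open import Relation.Binary using (Rel; IsEquivalence)
open import Relation.Nullary using (yes; no; ¬_)
open import Relation.Binary.PropositionalEquality using (_≡_; refl) renaming (sym to sym-≡; cong to ≡-cong)

record Signature : Set₁ where
  field
    Op : ℕ → Set
    𝟘 𝟙 : Op 0
open Signature public

data Pol : Set where
  pos neg : Pol

Polarity : Signature → Set
Polarity S = ∀ {n} → Op S n → Fin n → Pol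

data ExtOp (S : Signature) : ℕ → Set where
  σ : ∀ {n} → Op S n → ExtOp S n
  Δ ∇ : ExtOp S 1
  ι : ExtOp S 0

Ext : Signature → Signature
Ext S = record { Op = ExtOp S ; 𝟘 = σ (𝟘 S) ; 𝟙 = σ (𝟙 S) }

record Algebra (S : Signature) (a : Level) : Set (lsuc a) where
  field
    Carrier : Set a
    _≈_ : Rel Carrier a
    isEquivalence : IsEquivalence _≈_
    op : ∀ {n} → Op S n → (Fin n → Carrier) → Carrier
    op-cong : ∀ {n} (f : Op S n) {xs ys : Fin n → Carrier} →
              (∀ i → xs i ≈ ys i) → op f xs ≈ op f ys
  open IsEquivalence isEquivalence public

∣_∣ : ∀ {S a} → Algebra S a → Set a
∣ A ∣ = Algebra.Carrier A

data Term (S : Signature) (X : Set) : Set where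
  var : X → Term S X
  node : ∀ {n} → Op S n → (Fin n → Term S X) → Term S X

⟦_⟧ : ∀ {S X a} (A : Algebra S a) → Term S X → (X → ∣ A ∣) → ∣ A ∣
⟦ A ⟧ (var x) env = env x
⟦ A ⟧ (node f ts) env = Algebra.op A f (λ i → ⟦ A ⟧ (ts i) env)

record Equation (S : Signature) (X : Set) : Set where
  constructor _≐_
  field
    lhs rhs : Term S X

Holds : ∀ {S X a} (A : Algebra S a) → (X → ∣ A ∣) → Equation S X → Set a
Holds A env (l ≐ r) = Algebra._≈_ A (⟦ A ⟧ l env) (⟦ A ⟧ r env)

record QuasiId (S : Signature) : Set where
  field
    nv np : ℕ
    prem : Fin np → Equation S (Fin nv)
    concl : Equation S (Fin nv)

_⊨_ : ∀ {S a} → Algebra S a → QuasiId S → Set a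
A ⊨ φ = ∀ (env : Fin (QuasiId.nv φ) → ∣ A ∣) →
        (∀ j → Holds A env (QuasiId.prem φ j)) → Holds A env (QuasiId.concl φ)

Models : ∀ {S a} {QI : Set} → (QI → QuasiId S) → Algebra S a → Set a
Models Ax A = ∀ i → A ⊨ Ax i

record IsHom {S a} (A B : Algebra S a) (h : ∣ A ∣ → ∣ B ∣) : Set a where
  field
    cong : ∀ {x y} → Algebra._≈_ A x y → Algebra._≈_ B (h x) (h y)
    preserves : ∀ {n} (f : Op S n) (xs : Fin n → ∣ A ∣) →
                Algebra._≈_ B (h (Algebra.op A f xs)) (Algebra.op B f (λ i → h (xs i)))

record Hom {S a} (A B : Algebra S a) : Set a where
  constructor hom
  field
    fun : ∣ A ∣ → ∣ B ∣
    isHom : IsHom A B fun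
open Hom public

idHom : ∀ {S a} (A : Algebra S a) → Hom A A
idHom A = hom (λ x → x) record { cong = λ p → p ; preserves = λ f xs → Algebra.refl A }

_∘H_ : ∀ {S a} {A B C : Algebra S a} → Hom B C → Hom A B → Hom A C
_∘H_ {C = C} g h = hom (λ x → fun g (fun h x)) record
  { cong = λ p → IsHom.cong (isHom g) (IsHom.cong (isHom h) p)
  ; preserves = λ f xs → Algebra.trans C (IsHom.cong (isHom g) (IsHom.preserves (isHom h) f xs))
                                         (IsHom.preserves (isHom g) f _) }

pair : ∀ {ℓ} {C : Set ℓ} → C → C → Fin 2 → C
pair x y zero = x
pair x y (suc _) = y

module _ {S : Signature} {EI : Set} (E : EI → Equation S (Fin 2)) {a} (A : Algebra S a) where
  open Algebra A

  _≤E_ : Carrier → Carrier → Set a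
  x ≤E y = ∀ e → Holds A (pair x y) (E e)

  RelPol : Pol → Carrier → Carrier → Set a
  RelPol pos x y = x ≤E y
  RelPol neg x y = y ≤E x

upd : ∀ {ℓ} {C : Set ℓ} {n} → (Fin n → C) → Fin n → C → Fin n → C
upd xs k c i with i ≟ k
... | yes _ = c
... | no _ = xs i

record IsBPoalg {S : Signature} (ρ : Polarity S) {EI : Set} (E : EI → Equation S (Fin 2))
                {a} (A : Algebra S a) : Set a where
  open Algebra A
  _≤_ = _≤E_ E A
  𝟘ᴬ = op (𝟘 S) (λ ())
  𝟙ᴬ = op (𝟙 S) (λ ())
  field
    ≤-refl : ∀ x → x ≤ x
    ≤-antisym : ∀ x y → x ≤ y → y ≤ x → x ≈ y
    ≤-trans : ∀ x y z → x ≤ y → y ≤ z → x ≤ z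
    mono : ∀ {n} (f : Op S n) (k : Fin n) (xs : Fin n → Carrier) (c d : Carrier) →
           c ≤ d → RelPol E A (ρ f k) (op f (upd xs k c)) (op f (upd xs k d))
    bounded : ∀ x → (𝟘ᴬ ≤ x) × (x ≤ 𝟙ᴬ)

module Aux {S : Signature} {EI : Set} (E : EI → Equation S (Fin 2)) {a} (A : Algebra S a) where
  open Algebra A renaming (refl to ≈-refl; sym to ≈-sym; trans to ≈-trans)
  _≤_ = _≤E_ E A

  eval-cong : ∀ {X} (t : Term S X) {e e' : X → Carrier} → (∀ x → e x ≈ e' x) →
              ⟦ A ⟧ t e ≈ ⟦ A ⟧ t e'
  eval-cong (var x) p = p x
  eval-cong (node f ts) p = op-cong f (λ i → eval-cong (ts i) p)

  ≤-resp : ∀ {x x' y y'} → x ≈ x' → y ≈ y' → x ≤ y → x' ≤ y'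
  ≤-resp {x} {x'} {y} {y'} p q h e =
    ≈-trans (eval-cong (Equation.lhs (E e)) env) (≈-trans (h e) (≈-sym (eval-cong (Equation.rhs (E e)) env)))
    where env : ∀ i → pair x' y' i ≈ pair x y i
          env zero = ≈-sym p
          env (suc _) = ≈-sym q

  RelPol-resp : ∀ s {x x' y y'} → x ≈ x' → y ≈ y' → RelPol E A s x y → RelPol E A s x' y'
  RelPol-resp pos p q h = ≤-resp p q h
  RelPol-resp neg p q h = ≤-resp q p h

  cons : ∀ {n} → Carrier → (Fin n → Carrier) → Fin (suc n) → Carrier
  cons c v zero = c
  cons c v (suc i) = v i

  upd-cons : ∀ {n} c (v : Fin n → Carrier) k d i → cons c (upd v k d) i ≡ upd (cons c v) (suc k) d i
  upd-cons c v k d zero with zero ≟ suc k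
  ... | no _ = refl
  upd-cons c v k d (suc i) with i ≟ k | suc i ≟ suc k
  ... | yes _ | yes _ = refl
  ... | no _  | no _  = refl
  ... | yes p | no q  = ⊥-elim (q (≡-cong suc p))
  ... | no p  | yes q = ⊥-elim (p (suc-injective q))

  upd-self : ∀ {n} (xs : Fin n → Carrier) k i → upd xs k (xs k) i ≡ xs i
  upd-self xs k i with i ≟ k
  ... | yes refl = refl
  ... | no _ = refl

  upd0 : ∀ {n} (xs : Fin (suc n) → Carrier) c i → upd xs zero c i ≡ cons c (λ j → xs (suc j)) i
  upd0 xs c zero = refl
  upd0 xs c (suc i) = refl

  ≡⇒≈ : ∀ {x y} → x ≡ y → x ≈ y
  ≡⇒≈ refl = ≈-refl

  step : ∀ s (G : Carrier → Carrier) → (∀ c d → c ≤ d → RelPol E A s (G c) (G d)) →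
         ∀ x y → RelPol E A s x y → G x ≤ G y
  step pos G m x y h = m x y h
  step neg G m x y h = m y x h

  ≈⇒≤ : (∀ x → x ≤ x) → ∀ {x y} → x ≈ y → x ≤ y
  ≈⇒≤ r {x} p = ≤-resp ≈-refl p (r x)

  module _ (r : ∀ x → x ≤ x) (tr : ∀ x y z → x ≤ y → y ≤ z → x ≤ z) where
    joint : ∀ n (pol : Fin n → Pol) (g : (Fin n → Carrier) → Carrier) →
            (∀ {xs ys} → (∀ i → xs i ≈ ys i) → g xs ≈ g ys) →
            (∀ k xs c d → c ≤ d → RelPol E A (pol k) (g (upd xs k c)) (g (upd xs k d))) →
            ∀ xs ys → (∀ i → RelPol E A (pol i) (xs i) (ys i)) → g xs ≤ g ys
    joint zero pol g gc gm xs ys h = ≈⇒≤ r (gc (λ ()))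
    joint (suc n) pol g gc gm xs ys h =
      tr _ _ _ s1 (tr _ _ _ (≈⇒≤ r (gc (λ i → ≡⇒≈ (upd0 xs (ys zero) i))))
                      (tr _ _ _ ih (≈⇒≤ r (gc e2))))
      where
        s1 : g xs ≤ g (upd xs zero (ys zero))
        s1 = ≤-resp (gc (λ i → ≡⇒≈ (upd-self xs zero i))) ≈-refl
               (step (pol zero) (λ c → g (upd xs zero c)) (gm zero xs) (xs zero) (ys zero) (h zero))
        g' : (Fin n → Carrier) → Carrier
        g' v = g (cons (ys zero) v)
        gc' : ∀ {xs ys} → (∀ i → xs i ≈ ys i) → g' xs ≈ g' ys
        gc' p = gc λ { zero → ≈-refl ; (suc i) → p i }
        gm' : ∀ k xs c d → c ≤ d → RelPol E A (pol (suc k)) (g' (upd xs k c)) (g' (upd xs k d))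
        gm' k v c d cd = RelPol-resp (pol (suc k))
          (gc (λ i → ≡⇒≈ (sym-≡ (upd-cons (ys zero) v k c i))))
          (gc (λ i → ≡⇒≈ (sym-≡ (upd-cons (ys zero) v k d i))))
          (gm (suc k) (cons (ys zero) v) c d cd)
        ih : g' (λ i → xs (suc i)) ≤ g' (λ i → ys (suc i))
        ih = joint n (λ i → pol (suc i)) g' gc' gm' _ _ (λ i → h (suc i))
        e2 : ∀ i → cons (ys zero) (λ j → ys (suc j)) i ≈ ys i
        e2 zero = ≈-refl
        e2 (suc i) = ≈-refl

module _ {S : Signature} (ρ : Polarity S) {EI : Set} (E : EI → Equation S (Fin 2))
         {a} (A : Algebra S a) (P : IsBPoalg ρ E A) where
  private
    open Algebra A renaming (refl to ≈-refl; sym to ≈-sym; trans to ≈-trans)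
    open IsBPoalg P
    module X = Aux E A

  record Interval : Set a where
    constructor [_,_]⟨_⟩
    field
      lo hi : Carrier
      le : lo ≤ hi

  open Interval

  cSel dSel : Pol → Interval → Carrier
  cSel pos x = lo x
  cSel neg x = hi x
  dSel pos x = hi x
  dSel neg x = lo x

  private

    cd-rel : ∀ s x → RelPol E A s (cSel s x) (dSel s x)
    cd-rel pos x = le x
    cd-rel neg x = le x

    _≈I_ : Interval → Interval → Set a
    x ≈I y = (lo x ≈ lo y) × (hi x ≈ hi y)

    cSel-cong : ∀ s {x y} → x ≈I y → cSel s x ≈ cSel s y
    cSel-cong pos p = proj₁ p
    cSel-cong neg p = proj₂ p
    dSel-cong : ∀ s {x y} → x ≈I y → dSel s x ≈ dSel s y
    dSel-cong pos p = proj₂ p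
    dSel-cong neg p = proj₁ p

    I-op : ∀ {n} → ExtOp S n → (Fin n → Interval) → Interval
    I-op (σ f) xs =
      [ op f (λ i → cSel (ρ f i) (xs i)) , op f (λ i → dSel (ρ f i) (xs i)) ]⟨
        X.joint ≤-refl ≤-trans _ (ρ f) (op f) (op-cong f) (mono f) _ _ (λ i → cd-rel (ρ f i) (xs i)) ⟩
    I-op Δ xs = [ lo (xs zero) , lo (xs zero) ]⟨ ≤-refl _ ⟩
    I-op ∇ xs = [ hi (xs zero) , hi (xs zero) ]⟨ ≤-refl _ ⟩
    I-op ι xs = [ 𝟘ᴬ , 𝟙ᴬ ]⟨ proj₁ (bounded 𝟙ᴬ) ⟩

    I-op-cong : ∀ {n} (f : ExtOp S n) {xs ys} → (∀ i → xs i ≈I ys i) → I-op f xs ≈I I-op f ys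
    I-op-cong (σ f) p = op-cong f (λ i → cSel-cong (ρ f i) (p i)) , op-cong f (λ i → dSel-cong (ρ f i) (p i))
    I-op-cong Δ p = proj₁ (p zero) , proj₁ (p zero)
    I-op-cong ∇ p = proj₂ (p zero) , proj₂ (p zero)
    I-op-cong ι p = ≈-refl , ≈-refl

  𝓘 : Algebra (Ext S) a
  𝓘 = record
    { Carrier = Interval
    ; _≈_ = _≈I_
    ; isEquivalence = record
        { refl = ≈-refl , ≈-refl
        ; sym = λ p → ≈-sym (proj₁ p) , ≈-sym (proj₂ p)
        ; trans = λ p q → ≈-trans (proj₁ p) (proj₁ q) , ≈-trans (proj₂ p) (proj₂ q) }
    ; op = I-op
    ; op-cong = I-op-cong }

module _ {S : Signature} {a} {A B : Algebra S a} (h : Hom A B) where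
  private
    module A = Algebra A
    module B = Algebra B
    module H = IsHom (isHom h)

  eval-hom : ∀ {X} (t : Term S X) (env : X → ∣ A ∣) →
             Algebra._≈_ B (fun h (⟦ A ⟧ t env)) (⟦ B ⟧ t (λ x → fun h (env x)))
  eval-hom (var x) env = B.refl
  eval-hom (node f ts) env = B.trans (H.preserves f _) (B.op-cong f (λ i → eval-hom (ts i) env))

  module _ {EI : Set} (E : EI → Equation S (Fin 2)) where
    hom-≤ : ∀ {x y} → _≤E_ E A x y → _≤E_ E B (fun h x) (fun h y)
    hom-≤ {x} {y} p e =
      B.trans (B.sym (B.trans (eval-hom l (pair x y)) (Aux.eval-cong E B l env)))
        (B.trans (H.cong (p e)) (B.trans (eval-hom r (pair x y)) (Aux.eval-cong E B r env)))
      where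
        l = Equation.lhs (E e)
        r = Equation.rhs (E e)
        env : ∀ i → Algebra._≈_ B (fun h (pair x y i)) (pair (fun h x) (fun h y) i)
        env zero = B.refl
        env (suc _) = B.refl

module _ {S : Signature} (ρ : Polarity S) {EI : Set} (E : EI → Equation S (Fin 2))
         {a} {A B : Algebra S a} (PA : IsBPoalg ρ E A) (PB : IsBPoalg ρ E B) where
  private
    module B = Algebra B
    open Interval using (lo; hi; le)

  𝓘-map : Hom A B → Hom (𝓘 ρ E A PA) (𝓘 ρ E B PB)
  𝓘-map h = hom (λ x → [ fun h (lo x) , fun h (hi x) ]⟨ hom-≤ h E (le x) ⟩) record
    { cong = λ p → IsHom.cong (isHom h) (proj₁ p) , IsHom.cong (isHom h) (proj₂ p)
    ; preserves = pres }
    where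
      pres : ∀ {n} (f : ExtOp S n) xs → _
      pres (σ f) xs = B.trans (IsHom.preserves (isHom h) f _) (B.op-cong f (λ i → c (ρ f i) (xs i)))
                    , B.trans (IsHom.preserves (isHom h) f _) (B.op-cong f (λ i → d (ρ f i) (xs i)))
        where
          c : ∀ s x → B._≈_ (fun h (cSel ρ E A PA s x)) (cSel ρ E B PB s [ fun h (lo x) , fun h (hi x) ]⟨ hom-≤ h E (le x) ⟩)
          c pos x = B.refl
          c neg x = B.refl
          d : ∀ s x → B._≈_ (fun h (dSel ρ E A PA s x)) (dSel ρ E B PB s [ fun h (lo x) , fun h (hi x) ]⟨ hom-≤ h E (le x) ⟩)
          d pos x = B.refl
          d neg x = B.refl
      pres Δ xs = B.refl , B.refl
      pres ∇ xs = B.refl , B.refl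
      pres ι xs = B.trans (IsHom.preserves (isHom h) (𝟘 S) _) (B.op-cong (𝟘 S) (λ ()))
                , B.trans (IsHom.preserves (isHom h) (𝟙 S) _) (B.op-cong (𝟙 S) (λ ()))

module _ {S : Signature} {a} (J : Algebra (Ext S) a) where
  open Algebra J

  Δᴶ ∇ᴶ : Carrier → Carrier
  Δᴶ x = op Δ (λ _ → x)
  ∇ᴶ x = op ∇ (λ _ → x)

  InC : Carrier → Set a
  InC x = (∇ᴶ x ≈ x) × (x ≈ Δᴶ x)

  Closed : Set a
  Closed = ∀ {n} (f : Op S n) (xs : Fin n → Carrier) → (∀ i → InC (xs i)) → InC (op (σ f) xs)

  𝓒 : Closed → Algebra S a
  𝓒 cl = record
    { Carrier = Σ Carrier InC
    ; _≈_ = λ x y → proj₁ x ≈ proj₁ y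
    ; isEquivalence = record { refl = Algebra.refl J ; sym = Algebra.sym J ; trans = Algebra.trans J }
    ; op = λ f xs → op (σ f) (λ i → proj₁ (xs i)) , cl f (λ i → proj₁ (xs i)) (λ i → proj₂ (xs i))
    ; op-cong = λ f p → op-cong (σ f) p }

𝓒-map : ∀ {S a} {J K : Algebra (Ext S) a} (clJ : Closed J) (clK : Closed K) →
        Hom J K → Hom (𝓒 J clJ) (𝓒 K clK)
𝓒-map {S} {a} {J} {K} clJ clK g = hom (λ x → fun g (proj₁ x) , inC x) record
  { cong = IsHom.cong (isHom g)
  ; preserves = λ f xs → IsHom.preserves (isHom g) (σ f) _ }
  where
    module K = Algebra K
    inC : (x : Σ ∣ J ∣ (InC J)) → InC K (fun g (proj₁ x))
    inC (x , p , q) = K.trans (K.sym (IsHom.preserves (isHom g) ∇ (λ _ → x))) (IsHom.cong (isHom g) p)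
                    , K.trans (IsHom.cong (isHom g) q) (IsHom.preserves (isHom g) Δ (λ _ → x))

module Setting {S : Signature} (ρ : Polarity S) {QI : Set} (Ax : QI → QuasiId S)
               {EI : Set} (E : EI → Equation S (Fin 2)) (a : Level)
               (hQ : ∀ (A : Algebra S a) → Models Ax A → IsBPoalg ρ E A) where

  InQ : Algebra S a → Set a
  InQ A = Models Ax A

  𝓘Q : (A : Algebra S a) → InQ A → Algebra (Ext S) a
  𝓘Q A hA = 𝓘 ρ E A (hQ A hA)

  -- J belongs to the quasivariety generated by {𝓘(A) | A ∈ Q}:
  -- J satisfies every quasi-identity valid in all 𝓘(A), A ∈ Q.
  InIQ : Algebra (Ext S) a → Set (lsuc a)
  InIQ J = ∀ (φ : QuasiId (Ext S)) → (∀ (A : Algebra S a) (hA : InQ A) → 𝓘Q A hA ⊨ φ) → J ⊨ φ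

  𝓘∈IQ : ∀ A (hA : InQ A) → InIQ (𝓘Q A hA)
  𝓘∈IQ A hA φ h = h A hA

  𝓘Q-map : ∀ {A B} (hA : InQ A) (hB : InQ B) → Hom A B → Hom (𝓘Q A hA) (𝓘Q B hB)
  𝓘Q-map {A} {B} hA hB = 𝓘-map ρ E (hQ A hA) (hQ B hB)

  ιmap : (cl : ∀ J → InIQ J → Closed J) (A : Algebra S a) (hA : InQ A) →
         ∣ A ∣ → ∣ 𝓒 (𝓘Q A hA) (cl (𝓘Q A hA) (𝓘∈IQ A hA)) ∣
  ιmap cl A hA x = [ x , x ]⟨ IsBPoalg.≤-refl (hQ A hA) x ⟩
                  , (Algebra.refl A , Algebra.refl A) , (Algebra.refl A , Algebra.refl A)

_⊢_≈_ : ∀ {S a} (A : Algebra S a) → ∣ A ∣ → ∣ A ∣ → Set a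
A ⊢ x ≈ y = Algebra._≈_ A x y

-- A member J of IQ satisfies every quasi-identity that holds in all interval
-- algebras 𝓘(A), so each fact needed about J is obtained by exhibiting such a
-- quasi-identity: Δ and ∇ absorb one another, x is determined by (Δx, ∇x),
-- Δ and ∇ of f(x̄) are f applied to the endpoints of the xᵢ selected by the
-- polarity of f, Δι = 0 and ∇ι = 1, E(Δx, ∇x) holds, and so do the axioms of Q
-- with every variable x replaced by Δx.  In 𝓘(A) all of these reduce to
-- computations with degenerate intervals [c, c].  Together they say that the
-- fixed points C(J) of Δ and ∇ form a member of Q, that x ↦ [Δx, ∇x] is an
-- embedding of J into 𝓘(𝓒(J)), and that A ≅ 𝓒(𝓘(A)) via the degenerate
-- intervals.
module Submission where

open import Defs
open import Level using (Level)
open import Data.Fin using (Fin; zero; suc)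
open import Data.Product using (Σ; _×_; _,_; proj₁; proj₂)
open import Relation.Binary.PropositionalEquality as ≡ using (_≡_)

data End : Set where
  lower upper : End

opposite : End → End
opposite lower = upper
opposite upper = lower

-- The endpoint of f's k-th argument that determines endpoint e of f(x̄).
orient : End → Pol → End
orient e pos = e
orient e neg = opposite e

endOp : ∀ {S} → End → ExtOp S 1
endOp lower = Δ
endOp upper = ∇

boundOp : ∀ {S} → End → Op S 0
boundOp {S} lower = 𝟘 S
boundOp {S} upper = 𝟙 S

endᴶ : ∀ {S a} (J : Algebra (Ext S) a) → End → ∣ J ∣ → ∣ J ∣
endᴶ J e x = Algebra.op J (endOp e) (λ _ → x)

end : ∀ {S X} → End → Term (Ext S) X → Term (Ext S) X
end e t = node (endOp e) (λ _ → t)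

infix 25 _[_]
_[_] : ∀ {S X Y} → Term S X → (X → Term (Ext S) Y) → Term (Ext S) Y
var x [ s ] = s x
node f ts [ s ] = node (σ f) (λ i → ts i [ s ])

module QuasiIdentities (S : Signature) where

  equation : ∀ n → Term (Ext S) (Fin n) → Term (Ext S) (Fin n) → QuasiId (Ext S)
  equation n l r = record { nv = n ; np = 0 ; prem = λ () ; concl = l ≐ r }

  x₀ : Term (Ext S) (Fin 1)
  x₀ = var zero

  absorptionLaw : End → End → QuasiId (Ext S)
  absorptionLaw e e′ = equation 1 (end e (end e′ x₀)) (end e′ x₀)

  endpointsDetermine : QuasiId (Ext S)
  endpointsDetermine = record
    { nv = 2 ; np = 2
    ; prem = λ j → end (pair lower upper j) (var zero) ≐ end (pair lower upper j) (var (suc zero))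
    ; concl = var zero ≐ var (suc zero) }

  opLaw : Polarity S → End → ∀ {n} → Op S n → QuasiId (Ext S)
  opLaw ρ e {n} f = equation n (end e (node (σ f) var)) (node (σ f) (λ i → end (orient e (ρ f i)) (var i)))

  boundLaw : End → QuasiId (Ext S)
  boundLaw e = equation 0 (end e (node ι (λ ()))) (node (σ (boundOp {S} e)) (λ ()))

  orderLaw : Equation S (Fin 2) → QuasiId (Ext S)
  orderLaw eq = equation 1 (Equation.lhs eq [ endpoints ]) (Equation.rhs eq [ endpoints ])
    where
      endpoints : Fin 2 → Term (Ext S) (Fin 1)
      endpoints v = end (pair lower upper v) x₀

  lowerAxiom : QuasiId S → QuasiId (Ext S)
  lowerAxiom φ = record
    { nv = QuasiId.nv φ ; np = QuasiId.np φ
    ; prem = λ j → lowered (QuasiId.prem φ j)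
    ; concl = lowered (QuasiId.concl φ) }
    where
      lowered : Equation S (Fin (QuasiId.nv φ)) → Equation (Ext S) (Fin (QuasiId.nv φ))
      lowered (l ≐ r) = l [ (λ v → end lower (var v)) ] ≐ r [ (λ v → end lower (var v)) ]

module IntervalLaws {S : Signature} (ρ : Polarity S) {EI : Set} (E : EI → Equation S (Fin 2))
                    {a} (A : Algebra S a) (P : IsBPoalg ρ E A) where
  open Algebra A
  open Interval using (lo; hi; le)

  private
    I = 𝓘 ρ E A P
    module I = Algebra I
  open QuasiIdentities S

  endpoint : End → ∣ I ∣ → Carrier
  endpoint lower = lo
  endpoint upper = hi

  record Degenerate (c : Carrier) (y : ∣ I ∣) : Set a where
    constructor _,_
    field
      lo≈ : lo y ≈ c
      hi≈ : hi y ≈ c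

  degenerate-cong : ∀ {c c′ y y′} → Degenerate c y → Degenerate c′ y′ → c ≈ c′ → I ⊢ y ≈ y′
  degenerate-cong (l , h) (l′ , h′) c≈c′ = trans l (trans c≈c′ (sym l′)) , trans h (trans c≈c′ (sym h′))

  degenerate-injective : ∀ {c c′ y y′} → Degenerate c y → Degenerate c′ y′ → I ⊢ y ≈ y′ → c ≈ c′
  degenerate-injective (l , _) (l′ , _) y≈y′ = trans (sym l) (trans (proj₁ y≈y′) l′)

  point : Carrier → ∣ I ∣
  point x = [ x , x ]⟨ IsBPoalg.≤-refl P x ⟩

  point-degenerate : ∀ x → Degenerate x (point x)
  point-degenerate x = refl , refl

  endpoint-degenerate : ∀ e {c y} → Degenerate c y → endpoint e y ≈ c
  endpoint-degenerate lower = Degenerate.lo≈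
  endpoint-degenerate upper = Degenerate.hi≈

  endᴶ-degenerate : ∀ e y → Degenerate (endpoint e y) (endᴶ I e y)
  endᴶ-degenerate lower y = refl , refl
  endᴶ-degenerate upper y = refl , refl

  ∈C-degenerate : ∀ {y} → InC I y → Degenerate (lo y) y
  ∈C-degenerate (_ , (_ , hi≈lo)) = refl , hi≈lo

  cSel-orient : ∀ s y → cSel ρ E A P s y ≡ endpoint (orient lower s) y
  cSel-orient pos y = ≡.refl
  cSel-orient neg y = ≡.refl

  dSel-orient : ∀ s y → dSel ρ E A P s y ≡ endpoint (orient upper s) y
  dSel-orient pos y = ≡.refl
  dSel-orient neg y = ≡.refl

  endpoint-σ : ∀ e {n} (f : Op S n) ys →
               endpoint e (I.op (σ f) ys) ≈ op f (λ i → endpoint (orient e (ρ f i)) (ys i))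
  endpoint-σ lower f ys = op-cong f (λ i → reflexive (cSel-orient (ρ f i) (ys i)))
  endpoint-σ upper f ys = op-cong f (λ i → reflexive (dSel-orient (ρ f i) (ys i)))

  σ-degenerate : ∀ {n} (f : Op S n) {cs ys} → (∀ i → Degenerate (cs i) (ys i)) →
                 Degenerate (op f cs) (I.op (σ f) ys)
  σ-degenerate f {cs} {ys} d = at lower , at upper
    where
      at : ∀ e → endpoint e (I.op (σ f) ys) ≈ op f cs
      at e = trans (endpoint-σ e f ys) (op-cong f (λ i → endpoint-degenerate (orient e (ρ f i)) (d i)))

  subst-degenerate : ∀ {X Y} (t : Term S X) (s : X → Term (Ext S) Y) env cs →
                     (∀ v → Degenerate (cs v) (⟦ I ⟧ (s v) env)) →
                     Degenerate (⟦ A ⟧ t cs) (⟦ I ⟧ (t [ s ]) env)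
  subst-degenerate (var x) s env cs d = d x
  subst-degenerate (node f ts) s env cs d = σ-degenerate f (λ i → subst-degenerate (ts i) s env cs d)

  absorptionLaw-valid : ∀ e e′ → I ⊨ absorptionLaw e e′
  absorptionLaw-valid e e′ env _ =
    degenerate-cong (endᴶ-degenerate e _) (endᴶ-degenerate e′ (env zero))
      (endpoint-degenerate e (endᴶ-degenerate e′ (env zero)))

  endpointsDetermine-valid : I ⊨ endpointsDetermine
  endpointsDetermine-valid env same = proj₁ (same zero) , proj₁ (same (suc zero))

  opLaw-valid : ∀ e {n} (f : Op S n) → I ⊨ opLaw ρ e f
  opLaw-valid e f env _ =
    degenerate-cong (endᴶ-degenerate e _)
      (σ-degenerate f (λ i → endᴶ-degenerate (orient e (ρ f i)) (env i)))
      (endpoint-σ e f env)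

  boundLaw-valid : ∀ e → I ⊨ boundLaw e
  boundLaw-valid lower env _ = op-cong (𝟘 S) (λ ()) , op-cong (𝟘 S) (λ ())
  boundLaw-valid upper env _ = op-cong (𝟙 S) (λ ()) , op-cong (𝟙 S) (λ ())

  orderLaw-valid : ∀ i → I ⊨ orderLaw (E i)
  orderLaw-valid i env _ = degenerate-cong (side (Equation.lhs (E i))) (side (Equation.rhs (E i))) (le (env zero) i)
    where
      x = env zero
      side : ∀ t → Degenerate (⟦ A ⟧ t (pair (lo x) (hi x))) _
      side t = subst-degenerate t _ env (pair (lo x) (hi x)) λ { zero → refl , refl ; (suc _) → refl , refl }

  lowerAxiom-valid : ∀ φ → A ⊨ φ → I ⊨ lowerAxiom φ
  lowerAxiom-valid φ A⊨φ env prems =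
    degenerate-cong (lowered-degenerate (Equation.lhs (QuasiId.concl φ)))
                    (lowered-degenerate (Equation.rhs (QuasiId.concl φ)))
      (A⊨φ lows (λ j → degenerate-injective (lowered-degenerate (Equation.lhs (QuasiId.prem φ j)))
                                            (lowered-degenerate (Equation.rhs (QuasiId.prem φ j)))
                                            (prems j)))
    where
      lows = λ v → lo (env v)
      lowered-degenerate : ∀ t → Degenerate (⟦ A ⟧ t lows) (⟦ I ⟧ (t [ (λ v → end lower (var v)) ]) env)
      lowered-degenerate t = subst-degenerate t _ env lows (λ v → refl , refl)

  module _ (cl : Closed I) where

    diagonal : Carrier → ∣ 𝓒 I cl ∣
    diagonal x = point x , (refl , refl) , (refl , refl)

    diagonal-isHom : IsHom A (𝓒 I cl) diagonal
    diagonal-isHom = record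
      { cong = λ x≈y → x≈y , x≈y
      ; preserves = λ f xs →
          degenerate-cong (point-degenerate _) (σ-degenerate f (λ i → point-degenerate (xs i))) refl }

    lowerEndpoint : Hom (𝓒 I cl) A
    lowerEndpoint = hom (λ y → lo (proj₁ y)) record
      { cong = proj₁
      ; preserves = λ f ys → Degenerate.lo≈ (σ-degenerate f (λ i → ∈C-degenerate (proj₂ (ys i)))) }

    diagonal-lowerEndpoint : ∀ y → 𝓒 I cl ⊢ diagonal (lo (proj₁ y)) ≈ y
    diagonal-lowerEndpoint (y , y∈C) = degenerate-cong (point-degenerate (lo y)) (∈C-degenerate {y} y∈C) refl

subst-𝓒 : ∀ {S a} (J : Algebra (Ext S) a) (cl : Closed J) {X Y} (t : Term S X)
          (s : X → Term (Ext S) Y) env env′ →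
          (∀ v → J ⊢ proj₁ (env v) ≈ ⟦ J ⟧ (s v) env′) →
          J ⊢ proj₁ (⟦ 𝓒 J cl ⟧ t env) ≈ ⟦ J ⟧ (t [ s ]) env′
subst-𝓒 J cl (var x) s env env′ h = h x
subst-𝓒 J cl (node f ts) s env env′ h = Algebra.op-cong J (σ f) (λ i → subst-𝓒 J cl (ts i) s env env′ h)

hom-endᴶ : ∀ {S a} {J K : Algebra (Ext S) a} (g : Hom J K) e x →
           K ⊢ fun g (endᴶ J e x) ≈ endᴶ K e (fun g x)
hom-endᴶ g e x = IsHom.preserves (isHom g) (endOp e) (λ _ → x)

module IQLaws {S : Signature} (ρ : Polarity S) {QI : Set} (Ax : QI → QuasiId S)
              {EI : Set} (E : EI → Equation S (Fin 2)) (a : Level)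
              (hQ : ∀ (A : Algebra S a) → Models Ax A → IsBPoalg ρ E A) where
  open Setting ρ Ax E a hQ
  open QuasiIdentities S

  module _ (J : Algebra (Ext S) a) (hJ : InIQ J) where
    open Algebra J

    valid-in-J : ∀ φ → (∀ (A : Algebra S a) P → 𝓘 ρ E A P ⊨ φ) → J ⊨ φ
    valid-in-J φ v = hJ φ (λ A hA → v A (hQ A hA))

    absorb : ∀ e e′ x → endᴶ J e (endᴶ J e′ x) ≈ endᴶ J e′ x
    absorb e e′ x =
      valid-in-J (absorptionLaw e e′) (λ A P → IntervalLaws.absorptionLaw-valid ρ E A P e e′) (λ _ → x) (λ ())

    absorb-op : ∀ e e′ (xs : Fin 1 → Carrier) → endᴶ J e (op (endOp e′) xs) ≈ endᴶ J e′ (xs zero)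
    absorb-op e e′ xs =
      trans (op-cong (endOp e) (λ _ → op-cong (endOp e′) λ { zero → refl })) (absorb e e′ (xs zero))

    endpoints-determine : ∀ {x y} → Δᴶ J x ≈ Δᴶ J y → ∇ᴶ J x ≈ ∇ᴶ J y → x ≈ y
    endpoints-determine {x} {y} Δx≈Δy ∇x≈∇y =
      valid-in-J endpointsDetermine (λ A P → IntervalLaws.endpointsDetermine-valid ρ E A P) (pair x y)
        λ { zero → Δx≈Δy ; (suc _) → ∇x≈∇y }

    endᴶ-σ : ∀ e {n} (f : Op S n) xs →
             endᴶ J e (op (σ f) xs) ≈ op (σ f) (λ i → endᴶ J (orient e (ρ f i)) (xs i))
    endᴶ-σ e f xs = valid-in-J (opLaw ρ e f) (λ A P → IntervalLaws.opLaw-valid ρ E A P e f) xs (λ ())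

    endᴶ-ι : ∀ e {xs ys} → endᴶ J e (op ι xs) ≈ op (σ (boundOp {S} e)) ys
    endᴶ-ι e =
      trans (op-cong (endOp e) (λ _ → op-cong ι (λ ())))
        (trans (valid-in-J (boundLaw e) (λ A P → IntervalLaws.boundLaw-valid ρ E A P e) (λ ()) (λ ()))
               (op-cong (σ (boundOp {S} e)) (λ ())))

    endᴶ-∈C : ∀ e x → InC J (endᴶ J e x)
    endᴶ-∈C e x = absorb upper e x , sym (absorb lower e x)

    ∈C-endᴶ : ∀ {x} → InC J x → ∀ e → endᴶ J e x ≈ x
    ∈C-endᴶ (∇x≈x , _) upper = ∇x≈x
    ∈C-endᴶ (_ , x≈Δx) lower = sym x≈Δx

    closed : Closed J
    closed f xs xs∈C = fixed upper , sym (fixed lower)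
      where
        fixed : ∀ e → endᴶ J e (op (σ f) xs) ≈ op (σ f) xs
        fixed e = trans (endᴶ-σ e f xs) (op-cong (σ f) (λ i → ∈C-endᴶ (xs∈C i) (orient e (ρ f i))))

    module _ (cl : Closed J) where
      private
        C = 𝓒 J cl

      endpointᶜ : End → Carrier → ∣ C ∣
      endpointᶜ e x = endᴶ J e x , endᴶ-∈C e x

      -- Each x ∈ C(J) equals Δx, so an instance of an axiom of Q in 𝓒(J) is an
      -- instance of its lowered form in J.
      𝓒∈Q : InQ C
      𝓒∈Q i env prems =
        trans (side (Equation.lhs (QuasiId.concl φ))) (trans concl (sym (side (Equation.rhs (QuasiId.concl φ)))))
        where
          φ = Ax i
          values = λ v → proj₁ (env v)
          side : ∀ t → proj₁ (⟦ C ⟧ t env) ≈ ⟦ J ⟧ (t [ (λ v → end lower (var v)) ]) values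
          side t = subst-𝓒 J cl t _ env values (λ v → proj₂ (proj₂ (env v)))
          concl = hJ (lowerAxiom φ) (λ A hA → IntervalLaws.lowerAxiom-valid ρ E A (hQ A hA) φ (hA i)) values
                    (λ j → trans (sym (side (Equation.lhs (QuasiId.prem φ j))))
                                 (trans (prems j) (side (Equation.rhs (QuasiId.prem φ j)))))

      endpoints-ordered : ∀ x → _≤E_ E C (endpointᶜ lower x) (endpointᶜ upper x)
      endpoints-ordered x i =
        trans (side (Equation.lhs (E i)))
          (trans (valid-in-J (orderLaw (E i)) (λ A P → IntervalLaws.orderLaw-valid ρ E A P i) (λ _ → x) (λ ()))
                 (sym (side (Equation.rhs (E i)))))
        where
          side : ∀ t → proj₁ (⟦ C ⟧ t (pair (endpointᶜ lower x) (endpointᶜ upper x))) ≈ _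
          side t = subst-𝓒 J cl t _ _ (λ _ → x) λ { zero → refl ; (suc _) → refl }

      module _ (P : IsBPoalg ρ E C) where
        private
          IC = 𝓘 ρ E C P
          open IntervalLaws ρ E C P using (endpoint; endpoint-σ)

        γ-fun : Carrier → ∣ IC ∣
        γ-fun x = [ endpointᶜ lower x , endpointᶜ upper x ]⟨ endpoints-ordered x ⟩

        γ-endpoint : ∀ e x → proj₁ (endpoint e (γ-fun x)) ≡ endᴶ J e x
        γ-endpoint lower x = ≡.refl
        γ-endpoint upper x = ≡.refl

        γ-σ : ∀ e {n} (f : Op S n) xs →
              endᴶ J e (op (σ f) xs) ≈ proj₁ (endpoint e (Algebra.op IC (σ f) (λ i → γ-fun (xs i))))
        γ-σ e f xs =
          trans (endᴶ-σ e f xs)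
            (trans (op-cong (σ f) (λ i → sym (reflexive (γ-endpoint (orient e (ρ f i)) (xs i)))))
                   (sym (endpoint-σ e f _)))

        γ : Hom J IC
        γ = hom γ-fun record
          { cong = λ p → op-cong Δ (λ _ → p) , op-cong ∇ (λ _ → p)
          ; preserves = preserves }
          where
            preserves : ∀ {n} (f : ExtOp S n) xs →
                        IC ⊢ γ-fun (op f xs) ≈ Algebra.op IC f (λ i → γ-fun (xs i))
            preserves (σ f) xs = γ-σ lower f xs , γ-σ upper f xs
            preserves Δ xs = absorb-op lower lower xs , absorb-op upper lower xs
            preserves ∇ xs = absorb-op lower upper xs , absorb-op upper upper xs
            preserves ι xs = endᴶ-ι lower , endᴶ-ι upper

        γ-injective : ∀ {x y} → IC ⊢ γ-fun x ≈ γ-fun y → x ≈ y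
        γ-injective (Δx≈Δy , ∇x≈∇y) = endpoints-determine Δx≈Δy ∇x≈∇y

  faithful-on-C : ∀ {J K} (hJ : InIQ J) (hK : InIQ K) (g h : Hom J K) →
                  (∀ x → InC J x → K ⊢ fun g x ≈ fun h x) → ∀ x → K ⊢ fun g x ≈ fun h x
  faithful-on-C {J} {K} hJ hK g h agree x = endpoints-determine K hK (on lower) (on upper)
    where
      open Algebra K
      on : ∀ e → endᴶ K e (fun g x) ≈ endᴶ K e (fun h x)
      on e = trans (sym (hom-endᴶ g e x)) (trans (agree _ (endᴶ-∈C J hJ e x)) (hom-endᴶ h e x))

theorem8p7 :
  ∀ {S : Signature} (ρ : Polarity S) {QI : Set} (Ax : QI → QuasiId S)
    {EI : Set} (E : EI → Equation S (Fin 2)) (a : Level)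
    (hQ : ∀ (A : Algebra S a) → Models Ax A → IsBPoalg ρ E A) →
  let open Setting ρ Ax E a hQ in
  (∀ (J : Algebra (Ext S) a) → InIQ J → Closed J)
  ×
  (∀ (cl : ∀ J → InIQ J → Closed J) →
    (∀ J (hJ : InIQ J) → InQ (𝓒 J (cl J hJ)))
    × (∀ J (hJ : InIQ J) (x : ∣ 𝓒 J (cl J hJ) ∣) →
         𝓒 J (cl J hJ) ⊢ fun (𝓒-map (cl J hJ) (cl J hJ) (idHom J)) x ≈ x)
    × (∀ J K L (hJ : InIQ J) (hK : InIQ K) (hL : InIQ L) (g : Hom K L) (h : Hom J K)
         (x : ∣ 𝓒 J (cl J hJ) ∣) →
         𝓒 L (cl L hL) ⊢ fun (𝓒-map (cl J hJ) (cl L hL) (g ∘H h)) x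
                        ≈ fun (𝓒-map (cl K hK) (cl L hL) g) (fun (𝓒-map (cl J hJ) (cl K hK) h) x))
    × (∀ J K (hJ : InIQ J) (hK : InIQ K) (g h : Hom J K) →
         (∀ x → 𝓒 K (cl K hK) ⊢ fun (𝓒-map (cl J hJ) (cl K hK) g) x
                               ≈ fun (𝓒-map (cl J hJ) (cl K hK) h) x) →
         ∀ x → K ⊢ fun g x ≈ fun h x)
    × (∀ A (hA : InQ A) →
         IsHom A (𝓒 (𝓘Q A hA) (cl (𝓘Q A hA) (𝓘∈IQ A hA))) (ιmap cl A hA)
         × Σ (Hom (𝓒 (𝓘Q A hA) (cl (𝓘Q A hA) (𝓘∈IQ A hA))) A) (λ k →
             (∀ x → A ⊢ fun k (ιmap cl A hA x) ≈ x)
             × (∀ y → 𝓒 (𝓘Q A hA) (cl (𝓘Q A hA) (𝓘∈IQ A hA)) ⊢ ιmap cl A hA (fun k y) ≈ y)))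
    × (∀ A B (hA : InQ A) (hB : InQ B) (h : Hom A B) (x : ∣ A ∣) →
         𝓒 (𝓘Q B hB) (cl (𝓘Q B hB) (𝓘∈IQ B hB))
           ⊢ ιmap cl B hB (fun h x)
           ≈ fun (𝓒-map (cl (𝓘Q A hA) (𝓘∈IQ A hA)) (cl (𝓘Q B hB) (𝓘∈IQ B hB)) (𝓘Q-map hA hB h))
                 (ιmap cl A hA x))
    × (∀ (cq : ∀ J (hJ : InIQ J) → InQ (𝓒 J (cl J hJ))) →
         Σ (∀ J (hJ : InIQ J) → Hom J (𝓘Q (𝓒 J (cl J hJ)) (cq J hJ))) (λ γ →
           (∀ J (hJ : InIQ J) (x : ∣ J ∣) →
              (J ⊢ proj₁ (Interval.lo (fun (γ J hJ) x)) ≈ Δᴶ J x)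
              × (J ⊢ proj₁ (Interval.hi (fun (γ J hJ) x)) ≈ ∇ᴶ J x))
           × (∀ J (hJ : InIQ J) (x y : ∣ J ∣) →
                𝓘Q (𝓒 J (cl J hJ)) (cq J hJ) ⊢ fun (γ J hJ) x ≈ fun (γ J hJ) y →
                J ⊢ x ≈ y)
           × (∀ J K (hJ : InIQ J) (hK : InIQ K) (g : Hom J K) (x : ∣ J ∣) →
                𝓘Q (𝓒 K (cl K hK)) (cq K hK)
                  ⊢ fun (γ K hK) (fun g x)
                  ≈ fun (𝓘Q-map (cq J hJ) (cq K hK) (𝓒-map (cl J hJ) (cl K hK) g))
                        (fun (γ J hJ) x)))))
theorem8p7 ρ Ax E a hQ =
  closed ,
  λ cl →
    (λ J hJ → 𝓒∈Q J hJ (cl J hJ)) ,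
    (λ J hJ x → Algebra.refl J) ,
    (λ J K L hJ hK hL g h x → Algebra.refl L) ,
    (λ J K hJ hK g h agree → faithful-on-C hJ hK g h (λ x x∈C → agree (x , x∈C))) ,
    (λ A hA → let open IntervalLaws ρ E A (hQ A hA); clA = cl (𝓘Q A hA) (𝓘∈IQ A hA) in
      diagonal-isHom clA , lowerEndpoint clA , (λ x → Algebra.refl A) , diagonal-lowerEndpoint clA) ,
    (λ A B hA hB h x → Algebra.refl B , Algebra.refl B) ,
    λ cq →
      (λ J hJ → γ J hJ (cl J hJ) (hQ _ (cq J hJ))) ,
      (λ J hJ x → Algebra.refl J , Algebra.refl J) ,
      (λ J hJ x y → γ-injective J hJ (cl J hJ) (hQ _ (cq J hJ))) ,
      (λ J K hJ hK g x → Algebra.sym K (hom-endᴶ g lower x) , Algebra.sym K (hom-endᴶ g upper x))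
  where open IQLaws ρ Ax E a hQ
        open Setting ρ Ax E a hQ
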